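{- Let $F$ be a clause-set with $\operatorname{var}(F)\subseteq \mathcal{VA}_0$. Run algorithm $\mathcal{A}_1(F)$ (defined in the context) with any SAT oracle $\mathcal{O}_1$ (i.e., for every sequence of oracle answers consistent with the oracle's specification). Then the algorithm terminates and returns a maximal autarky $\varphi\in\operatorname{aut}_{\max}(F)$, and it makes at most $\min(n_a(F)+1,\,n(F))$ calls of the oracle $\mathcal{O}_1$.
   Context: Literals and clauses: there is a set $\mathcal{VA}$ of variables; each literal is a variable $v$ or its complement $\overline{v}$, with $\overline{\overline{x}}=x$, and $\operatorname{var}(x)$ is the underlying variable; for a set $L$ of literals/variables, $\operatorname{lit}(L)=L\cup\overline{L}$. A clause is a finite set of literals without a complementary pair; a clause-set is a finite set of clauses; $\bot=\emptyset$ is the empty clause and $\top=\emptyset$ the empty clause-set. $\operatorname{var}(C)$, $\operatorname{var}(F)$ are the sets of underlying variables, $n(F)=|\operatorname{var}(F)|$. A partial assignment is a map $\varphi:V\to\{0,1\}$ with $V\subseteq\mathcal{VA}$ finite, $\operatorname{var}(\varphi)=V$, extended to literals by $\varphi(\overline v)=1-\varphi(v)$; $\epsilon$ denotes the empty assignment, and $\varphi^{ -1}(\delta)$ is the set of literals over $\operatorname{var}(\varphi)$ with value $\delta$. Application: $\varphi*F=\{C\setminus\varphi^{ -1}(0): C\in F,\ C\cap\varphi^{ -1}(1)=\emptyset\}$; $F$ is satisfiable iff $\varphi*F=\top$ for some $\varphi$. For a set $V$ of variables, $F[V]=\{C\cap\operatorname{lit}(V):C\in F\}\setminus\{\bot\}$.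 Autarkies: $\varphi$ is an autarky for $F$ if every $C\in F$ with $\operatorname{var}(C)\cap\operatorname{var}(\varphi)\neq\emptyset$ contains a literal $x$ with $\varphi(x)=1$. $\operatorname{aut}_r(F)$ is the set of autarkies $\varphi$ for $F$ with $\operatorname{var}(\varphi)\subseteq\operatorname{var}(F)$; $\operatorname{var}(\operatorname{aut}_r(F))=\bigcup_{\varphi\in\operatorname{aut}_r(F)}\operatorname{var}(\varphi)$; $n_a(F)=|\operatorname{var}(\operatorname{aut}_r(F))|$. $\operatorname{aut}_{\max}(F)$ is the set of inclusion-maximal elements of $\operatorname{aut}_r(F)$ (maximal autarkies). Translation: fix $\mathcal{VA}_0\subset\mathcal{VA}$ ("primary variables") and an injection $t$ from the literals over $\mathcal{VA}_0$ into $\mathcal{VA}$ with $\mathcal{VA}_0\cap t(\operatorname{lit}(\mathcal{VA}_0))=\emptyset$ and $\mathcal{VA}_0\cup t(\operatorname{lit}(\mathcal{VA}_0))=\mathcal{VA}$. The sets $\{v,t(v),t(\overline v)\}$, $v\in\mathcal{VA}_0$, partition $\mathcal{VA}$; a set of variables is saturated if it is a union of such triples, and the saturation $V'$ of $V$ is the smallest saturated superset. For finite $V\subseteq\mathcal{VA}_0$ and $F$ with $\operatorname{var}(F)\subseteq\mathcal{VA}_0$, $t_V(F)$ consists of: (I) for each $C\in F$ and $x\in C$ with $\operatorname{var}(x)\in V$, the clause $\{\overline{t(\overline x)}\}\cup\{t(y): y\in C\setminus\{x\},\operatorname{var}(y)\in V\}$; (II) for each $v\in V$ the clause $\{\overline{t(v)},\overline{t(\overline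 v)}\}$; (III) for each $v\in V$ the clauses $\{\overline v,t(v),t(\overline v)\}$, $\{\overline{t(v)},v\}$, $\{\overline{t(\overline v)},v\}$. Put $t(F)=t_{\operatorname{var}(F)}(F)$. For a partial assignment $\varphi$ with $\operatorname{var}(\varphi)\subseteq\mathcal{VA}_0$, $t(\varphi)$ is the partial assignment whose domain is the saturation of $\operatorname{var}(\varphi)$, with $t(\varphi)(v)=1$ for $v\in\operatorname{var}(\varphi)$ and $t(\varphi)(t(x))=1$ iff $\varphi(x)=1$ (else $0$) for literals $x$ over $\operatorname{var}(\varphi)$. For a partial assignment $\psi$ with saturated domain, $t^{ -1}(\psi)$ is the partial assignment with domain $\{v\in\mathcal{VA}_0: \psi(v)=1\}$ and $t^{ -1}(\psi)(v)=\psi(t(v))$. SAT oracle $\mathcal{O}_1$: on input clause-set $G$ returns $0$ if $G$ is unsatisfiable, and otherwise $(1,\psi)$ for some partial assignment $\psi$ with $\operatorname{var}(\psi)\subseteq\operatorname{var}(G)$ and $\psi*G=\top$. Algorithm $\mathcal{A}_1(F)$: (1) set $\varphi:=\epsilon$, $P:=\{\operatorname{var}(F)\}$, $G:=t(F)$. (2) While $\operatorname{var}(P)\neq\emptyset$: compute $\mathcal{O}_1(G\cup P)$; if the answer is $0$, set $P:=\top$, $G:=\top$; if it is $(1,\psi)$, set $\psi':=t^{ -1}(\psi)$, $P:=P[\operatorname{var}(P)\setminus\operatorname{var}(\psi')]$, $G:=t(\psi')*G$, $\varphi:=\varphi\cup\psi'$. (3) Return $\varphi$. -}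

module Defs where

open import Data.Nat as ℕ using (ℕ; zero; suc)
open import Data.Bool using (Bool; true; false; not)
open import Data.Maybe using (Maybe; just; nothing)
import Data.Maybe.Properties as MaybeP
import Data.Bool.Properties as BoolP
open import Data.Product using (Σ; ∃; _×_; _,_; proj₁; proj₂)
open import Data.Sum using (_⊎_; inj₁; inj₂)
open import Data.List using (List; []; _∷_; _++_; map; concatMap; filter; length; deduplicate)
open import Data.List.Relation.Unary.All using (All)
import Data.List.Relation.Unary.All as All
open import Data.List.Relation.Unary.Any using (Any)
import Data.List.Relation.Unary.Any as Any
open import Relation.Nullary using (¬_; Dec; yes; no)
open import Relation.Nullary.Decidable using (_×-dec_; _→-dec_; ¬?; does)
open import Relation.Binary.Definitions using (DecidableEquality)
open import Relation.Binary.PropositionalEquality using (_≡_; _≢_; refl; cong)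
import Data.List.Membership.DecPropositional as DecMem

data Lit (V : Set) : Set where
  pos : V → Lit V
  neg : V → Lit V

compl : {V : Set} → Lit V → Lit V
compl (pos v) = neg v
compl (neg v) = pos v

var : {V : Set} → Lit V → V
var (pos v) = v
var (neg v) = v

sign : {V : Set} → Lit V → Bool
sign (pos _) = true
sign (neg _) = false

Lit-≟ : {V : Set} → DecidableEquality V → DecidableEquality (Lit V)
Lit-≟ _≟_ (pos u) (pos v) with u ≟ v
... | yes refl = yes refl
... | no u≢v = no λ { refl → u≢v refl }
Lit-≟ _≟_ (pos u) (neg v) = no λ ()
Lit-≟ _≟_ (neg u) (pos v) = no λ ()
Lit-≟ _≟_ (neg u) (neg v) with u ≟ v
... | yes refl = yes refl
... | no u≢v = no λ { refl → u≢v refl }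

Clause : Set → Set
Clause V = List (Lit V)

ClauseSet : Set → Set
ClauseSet V = List (Clause V)

-- A partial assignment is represented by a finite list of (variable , value)
-- pairs; its meaning is given by `lookupPA` (first occurrence wins), so it is
-- always a function on the finite domain  dom φ.
PAss : Set → Set
PAss V = List (V × Bool)

dom : {V : Set} → PAss V → List V
dom = map proj₁

module Generic {V : Set} (_≟_ : DecidableEquality V) where

  open DecMem _≟_ public using (_∈?_)
  open import Data.List.Membership.Propositional public using (_∈_; _∉_)

  _≟L_ : DecidableEquality (Lit V)
  _≟L_ = Lit-≟ _≟_

  lookupPA : PAss V → V → Maybe Bool
  lookupPA [] v = nothing
  lookupPA ((w , b) ∷ φ) v with v ≟ w
  ... | yes _ = just b
  ... | no _  = lookupPA φ v

  valLit : PAss V → Lit V → Maybe Bool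
  valLit φ (pos v) = lookupPA φ v
  valLit φ (neg v) with lookupPA φ v
  ... | just b  = just (not b)
  ... | nothing = nothing

  trueLit? : (φ : PAss V) (x : Lit V) → Dec (valLit φ x ≡ just true)
  trueLit? φ x = MaybeP.≡-dec BoolP._≟_ (valLit φ x) (just true)

  falseLit? : (φ : PAss V) (x : Lit V) → Dec (valLit φ x ≡ just false)
  falseLit? φ x = MaybeP.≡-dec BoolP._≟_ (valLit φ x) (just false)

  varCS : ClauseSet V → List V
  varCS F = deduplicate _≟_ (concatMap (map var) F)

  nVars : ClauseSet V → ℕ
  nVars F = length (varCS F)

  _*_ : PAss V → ClauseSet V → ClauseSet V
  φ * F = map (filter (λ x → ¬? (falseLit? φ x)))
              (filter (λ C → ¬? (Any.any? (trueLit? φ) C)) F)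

  -- ⊤ is the empty clause-set
  Satisfiable : ClauseSet V → Set
  Satisfiable F = ∃ λ (φ : PAss V) → φ * F ≡ []

  nonEmpty? : (C : Clause V) → Dec (C ≢ [])
  nonEmpty? [] = no λ ne → ne refl
  nonEmpty? (_ ∷ _) = yes λ ()

  restrict : ClauseSet V → List V → ClauseSet V
  restrict F W = filter nonEmpty? (map (filter (λ x → var x ∈? W)) F)

  _⊑_ : PAss V → PAss V → Set
  φ ⊑ ψ = ∀ v b → lookupPA φ v ≡ just b → lookupPA ψ v ≡ just b

  Touches : PAss V → Clause V → Set
  Touches φ C = Any (λ x → var x ∈ dom φ) C

  Autarky : PAss V → ClauseSet V → Set
  Autarky φ F = All (λ C → Touches φ C → Any (λ x → valLit φ x ≡ just true) C) F

  autarky? : (φ : PAss V) (F : ClauseSet V) → Dec (Autarky φ F)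
  autarky? φ F = All.all? (λ C → Any.any? (λ x → var x ∈? dom φ) C
                                  →-dec Any.any? (trueLit? φ) C) F

  AutR : ClauseSet V → PAss V → Set
  AutR F φ = Autarky φ F × All (λ v → v ∈ varCS F) (dom φ)

  AutMax : ClauseSet V → PAss V → Set
  AutMax F φ = AutR F φ × (∀ ψ → AutR F ψ → φ ⊑ ψ → ψ ⊑ φ)

  allPAss : List V → List (PAss V)
  allPAss [] = [] ∷ []
  allPAss (v ∷ vs) = concatMap (λ φ → φ ∷ ((v , true) ∷ φ) ∷ ((v , false) ∷ φ) ∷ [])
                               (allPAss vs)

  varAut : ClauseSet V → List V
  varAut F = filter (λ v → Any.any? (λ φ → autarky? φ F ×-dec (v ∈? dom φ))
                                    (allPAss (varCS F)))
                    (varCS F)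

  nAut : ClauseSet V → ℕ
  nAut F = length (varAut F)

-- Primary variables VA₀ = ℕ, all variables VA = VA₀ ⊎ t(lit(VA₀))

data Var : Set where
  prim : ℕ → Var
  tv   : Lit ℕ → Var

_≟V_ : DecidableEquality Var
prim m ≟V prim n with m ℕ.≟ n
... | yes refl = yes refl
... | no m≢n = no λ { refl → m≢n refl }
prim _ ≟V tv _ = no λ ()
tv _ ≟V prim _ = no λ ()
tv x ≟V tv y with Lit-≟ ℕ._≟_ x y
... | yes refl = yes refl
... | no x≢y = no λ { refl → x≢y refl }

module P = Generic ℕ._≟_
module W = Generic _≟V_

embLit : Lit ℕ → Lit Var
embLit (pos v) = pos (prim v)
embLit (neg v) = neg (prim v)

tV : List ℕ → ClauseSet ℕ → ClauseSet Var
tV Vs F = concatMap clausesI F ++ concatMap clausesII+III Vs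
  where
  clausesI : Clause ℕ → ClauseSet Var
  clausesI C = concatMap
    (λ x → (neg (tv (compl x)) ∷
              map (λ y → pos (tv y))
                  (filter (λ y → ¬? (Lit-≟ ℕ._≟_ y x) ×-dec (var y P.∈? Vs)) C)) ∷ [])
    (filter (λ x → var x P.∈? Vs) C)
  clausesII+III : ℕ → ClauseSet Var
  clausesII+III v =
      (neg (tv (pos v)) ∷ neg (tv (neg v)) ∷ [])
    ∷ (neg (prim v) ∷ pos (tv (pos v)) ∷ pos (tv (neg v)) ∷ [])
    ∷ (neg (tv (pos v)) ∷ pos (prim v) ∷ [])
    ∷ (neg (tv (neg v)) ∷ pos (prim v) ∷ [])
    ∷ []

tCS : ClauseSet ℕ → ClauseSet Var
tCS F = tV (P.varCS F) F

tPA : PAss ℕ → PAss Var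
tPA = concatMap (λ { (v , b) → (prim v , true) ∷ (tv (pos v) , b) ∷ (tv (neg v) , not b) ∷ [] })

tInv : PAss Var → PAss ℕ
tInv ψ = concatMap entry (dom ψ)
  where
  entry : Var → PAss ℕ
  entry (tv _) = []
  entry (prim v) with W.lookupPA ψ (prim v) | W.lookupPA ψ (tv (pos v))
  ... | just true | just b = (v , b) ∷ []
  ... | _ | _ = []

data Answer : Set where
  unsatA : Answer
  satA   : PAss Var → Answer

ValidAnswer : ClauseSet Var → Answer → Set
ValidAnswer G unsatA = ¬ W.Satisfiable G
ValidAnswer G (satA ψ) = All (λ w → w W.∈ W.varCS G) (dom ψ) × (ψ W.* G ≡ [])

record State : Set where
  constructor ⟨_,_,_⟩
  field
    φ : PAss ℕ
    Pc : ClauseSet Var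
    G : ClauseSet Var
open State public

initState : ClauseSet ℕ → State
initState F = ⟨ [] , map (λ v → pos (prim v)) (P.varCS F) ∷ [] , tCS F ⟩

step : State → Answer → State
step s unsatA = ⟨ φ s , [] , [] ⟩
step s (satA ψ) =
  let ψ' = tInv ψ in
  ⟨ φ s ++ ψ'
  , W.restrict (Pc s) (filter (λ w → ¬? (w W.∈? map prim (dom ψ'))) (W.varCS (Pc s)))
  , tPA ψ' W.* G s ⟩

-- Run s φ k : some complete execution of the loop from state s, with oracle
-- answers obeying the specification, returns φ after exactly k oracle calls.
data Run : State → PAss ℕ → ℕ → Set where
  halt : ∀ {s} → W.varCS (Pc s) ≡ [] → Run s (φ s) zero
  call : ∀ {s a r k} → W.varCS (Pc s) ≢ [] → ValidAnswer (G s ++ Pc s) a →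
         Run (step s a) r k → Run s r (suc k)

-- Terminates s : every execution from s (whatever the valid oracle answers) halts.
data Terminates : State → Set where
  halt : ∀ {s} → W.varCS (Pc s) ≡ [] → Terminates s
  call : ∀ {s} → W.varCS (Pc s) ≢ [] →
         (∀ a → ValidAnswer (G s ++ Pc s) a → Terminates (step s a)) → Terminates s

ProperClauseSet : ClauseSet ℕ → Set
ProperClauseSet F = All (λ C → ∀ x → x P.∈ C → compl x P.∉ C) F

-- An assignment Ψ satisfying t(F) encodes the autarky t⁻¹(Ψ): the primary variable v says "v is
-- assigned", t(x) says "x is true", the clauses (II) and (III) make this consistent, and the clause (I)
-- for a literal x of C says that falsifying x forces some other literal of C to be true.  Conversely an
-- autarky ψ yields the satisfying assignment t(ψ) extended by 0.  The loop keeps φ an autarky, keeps G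
-- satisfied by exactly those χ for which t(φ) followed by χ satisfies t(F), and keeps P the single
-- clause of the primary variables not yet assigned.  So a satisfiable call assigns at least one new
-- variable, while an unsatisfiable call or an empty P shows that no autarky extends φ to a new variable,
-- i.e. that φ is maximal.  Counting assigned variables bounds the calls by n_a(F) + 1 (only the last
-- call can be unsatisfiable) and by n(F) (an unsatisfiable call still leaves a variable unassigned).

module Submission where

open import Defs
open import Data.Bool using (Bool; true; false; not)
open import Data.Bool.Properties using (not-involutive)
import Data.Bool.Properties as BoolP
open import Data.Empty using (⊥-elim)
open import Data.List using (List; []; _∷_; _++_; map; concatMap; filter; length)
import Data.List.Properties as ListP
open import Data.List.Membership.Propositional using (_∈_; _∉_; find; lose)
open import Data.List.Membership.Propositional.Properties
open import Data.List.Relation.Binary.Sublist.Propositional using (⊆-refl)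
import Data.List.Relation.Binary.Sublist.Propositional.Properties as SublistP
open import Data.List.Relation.Unary.All as All using (All; []; _∷_)
import Data.List.Relation.Unary.All.Properties as AllP
open import Data.List.Relation.Unary.Any as Any using (Any; here; there)
import Data.List.Relation.Unary.Any.Properties as AnyP
open import Data.Maybe as Maybe using (Maybe; just; nothing)
open import Data.Nat as ℕ using (ℕ; zero; suc; _≤_; _<_; _+_; _⊓_; s≤s)
import Data.Nat.Properties as ℕP
open import Data.Product using (∃; _×_; _,_; proj₁; proj₂)
open import Data.Product.Properties using (≡-dec)
open import Data.Sum using (_⊎_; inj₁; inj₂; [_,_]′)
open import Function using (_∘_)
open import Level using (0ℓ)
open import Relation.Binary.Definitions using (DecidableEquality)
open import Relation.Binary.PropositionalEquality
  using (_≡_; _≢_; _≗_; refl; sym; trans; cong; cong₂; subst)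
open import Relation.Nullary using (¬_; Dec; yes; no; ¬?)
open import Relation.Nullary.Decidable using (_×-dec_)
open import Relation.Unary using (Pred; Decidable)

open import Data.List.Membership.DecPropositional (≡-dec ℕ._≟_ BoolP._≟_)
  using () renaming (_∈?_ to _∈PAss?_)

-- Partial assignments and clause-sets

module AssignmentProperties {V : Set} (_≟_ : DecidableEquality V) where
  open Generic _≟_ hiding (_∈_; _∉_)

  lookupPA-++ˡ : ∀ φ ψ {v b} → lookupPA φ v ≡ just b → lookupPA (φ ++ ψ) v ≡ just b
  lookupPA-++ˡ ((w , _) ∷ φ) ψ {v} e with v ≟ w
  ... | yes _ = e
  ... | no _ = lookupPA-++ˡ φ ψ e

  lookupPA-++ʳ : ∀ φ ψ {v} → lookupPA φ v ≡ nothing → lookupPA (φ ++ ψ) v ≡ lookupPA ψ v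
  lookupPA-++ʳ [] ψ e = refl
  lookupPA-++ʳ ((w , _) ∷ φ) ψ {v} e with v ≟ w
  ... | no _ = lookupPA-++ʳ φ ψ e

  lookupPA⇒∈dom : ∀ φ {v b} → lookupPA φ v ≡ just b → v ∈ dom φ
  lookupPA⇒∈dom ((w , _) ∷ φ) {v} e with v ≟ w
  ... | yes v≡w = here v≡w
  ... | no _ = there (lookupPA⇒∈dom φ e)

  ∈dom⇒lookupPA : ∀ φ {v} → v ∈ dom φ → ∃ λ b → lookupPA φ v ≡ just b
  ∈dom⇒lookupPA ((w , b) ∷ φ) {v} v∈ with v ≟ w | v∈
  ... | yes _ | _ = b , refl
  ... | no v≢w | here v≡w = ⊥-elim (v≢w v≡w)
  ... | no _ | there v∈φ = ∈dom⇒lookupPA φ v∈φ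

  lookupPA≡nothing⇒∉dom : ∀ φ {v} → lookupPA φ v ≡ nothing → v ∉ dom φ
  lookupPA≡nothing⇒∉dom φ e v∈ with ∈dom⇒lookupPA φ v∈
  ... | _ , e′ with () ← trans (sym e) e′

  lookupPA⇒∈ : ∀ φ {v b} → lookupPA φ v ≡ just b → (v , b) ∈ φ
  lookupPA⇒∈ ((w , c) ∷ φ) {v} e with v ≟ w
  lookupPA⇒∈ ((w , c) ∷ φ) {v} refl | yes refl = here refl
  ... | no _ = there (lookupPA⇒∈ φ e)

  lookupPA-graph : ∀ φ (f : V → Maybe Bool) →
                   (∀ {v b} → (v , b) ∈ φ → f v ≡ just b) → (∀ {v b} → f v ≡ just b → (v , b) ∈ φ) →
                   lookupPA φ ≗ f
  lookupPA-graph φ f φ⊆f f⊆φ v with lookupPA φ v in e | f v in e′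
  ... | just b | _ = trans (sym (φ⊆f (lookupPA⇒∈ φ e))) e′
  ... | nothing | nothing = refl
  ... | nothing | just b = ⊥-elim (lookupPA≡nothing⇒∉dom φ e (∈-map⁺ proj₁ (f⊆φ e′)))

  lookupPA-map : ∀ (c : Bool) {u} us → u ∈ us → lookupPA (map (_, c) us) u ≡ just c
  lookupPA-map c {u} (w ∷ us) u∈ with u ≟ w | u∈
  ... | yes _ | _ = refl
  ... | no u≢w | here u≡w = ⊥-elim (u≢w u≡w)
  ... | no _ | there u∈us = lookupPA-map c us u∈us

  ≗⇒⊑ : ∀ {φ ψ} → lookupPA φ ≗ lookupPA ψ → φ ⊑ ψ
  ≗⇒⊑ φ≗ψ v _ e = trans (sym (φ≗ψ v)) e

  dom-mono : ∀ {φ ψ} → φ ⊑ ψ → ∀ {v} → v ∈ dom φ → v ∈ dom ψ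
  dom-mono {φ} {ψ} φ⊑ψ v∈ with ∈dom⇒lookupPA φ v∈
  ... | _ , e = lookupPA⇒∈dom ψ (φ⊑ψ _ _ e)

  ⊑-++ˡ : ∀ φ ψ → φ ⊑ (φ ++ ψ)
  ⊑-++ˡ φ ψ _ _ = lookupPA-++ˡ φ ψ

  valLit-neg : ∀ φ v → valLit φ (neg v) ≡ Maybe.map not (lookupPA φ v)
  valLit-neg φ v with lookupPA φ v
  ... | just _ = refl
  ... | nothing = refl

  valLit-neg⁻ : ∀ φ v {b} → valLit φ (neg v) ≡ just b → lookupPA φ v ≡ just (not b)
  valLit-neg⁻ φ v e with lookupPA φ v
  valLit-neg⁻ φ v refl | just c = cong just (sym (not-involutive c))

  valLit-neg⁺ : ∀ φ v {b} → lookupPA φ v ≡ just (not b) → valLit φ (neg v) ≡ just b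
  valLit-neg⁺ φ v {b} e with lookupPA φ v
  valLit-neg⁺ φ v {b} refl | just _ = cong just (not-involutive b)

  ∈dom⇒valLit : ∀ φ x → var x ∈ dom φ → ∃ λ b → valLit φ x ≡ just b
  ∈dom⇒valLit φ (pos v) v∈ = ∈dom⇒lookupPA φ v∈
  ∈dom⇒valLit φ (neg v) v∈ with ∈dom⇒lookupPA φ v∈
  ... | b , e = not b , valLit-neg⁺ φ v (trans e (cong just (sym (not-involutive b))))

  valLit≡nothing⁻ : ∀ φ x → valLit φ x ≡ nothing → lookupPA φ (var x) ≡ nothing
  valLit≡nothing⁻ φ (pos v) e = e
  valLit≡nothing⁻ φ (neg v) e with lookupPA φ v
  ... | nothing = refl

  valLit≡just⇒∈dom : ∀ φ x {b} → valLit φ x ≡ just b → var x ∈ dom φ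
  valLit≡just⇒∈dom φ (pos v) e = lookupPA⇒∈dom φ e
  valLit≡just⇒∈dom φ (neg v) e = lookupPA⇒∈dom φ (valLit-neg⁻ φ v e)

  valLit-compl-true⁻ : ∀ φ x → valLit φ (compl x) ≡ just true → valLit φ x ≡ just false
  valLit-compl-true⁻ φ (pos v) e = valLit-neg⁻ φ v e
  valLit-compl-true⁻ φ (neg v) e = valLit-neg⁺ φ v e

  valLit-cong : ∀ {φ ψ} x → lookupPA φ (var x) ≡ lookupPA ψ (var x) → valLit φ x ≡ valLit ψ x
  valLit-cong (pos v) e = e
  valLit-cong {φ} {ψ} (neg v) e =
    trans (valLit-neg φ v) (trans (cong (Maybe.map not) e) (sym (valLit-neg ψ v)))

  valLit-mono : ∀ {φ ψ} → φ ⊑ ψ → ∀ x {b} → valLit φ x ≡ just b → valLit ψ x ≡ just b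
  valLit-mono φ⊑ψ (pos v) e = φ⊑ψ v _ e
  valLit-mono {φ} {ψ} φ⊑ψ (neg v) e = valLit-neg⁺ ψ v (φ⊑ψ v _ (valLit-neg⁻ φ v e))

  valLit-++ʳ : ∀ φ ψ x → valLit φ x ≡ nothing → valLit (φ ++ ψ) x ≡ valLit ψ x
  valLit-++ʳ φ ψ x e = valLit-cong x (lookupPA-++ʳ φ ψ (valLit≡nothing⁻ φ x e))

  Sat : PAss V → ClauseSet V → Set
  Sat χ = All (Any (λ x → valLit χ x ≡ just true))

  Sat-mono : ∀ {φ ψ} → φ ⊑ ψ → ∀ {G} → Sat φ G → Sat ψ G
  Sat-mono {φ} {ψ} φ⊑ψ = All.map (Any.map λ {x} → valLit-mono {φ} {ψ} φ⊑ψ x)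

  Sat⇒*≡[] : ∀ χ G → Sat χ G → χ * G ≡ []
  Sat⇒*≡[] χ [] [] = refl
  Sat⇒*≡[] χ (D ∷ G) (satD ∷ satG) with Any.any? (trueLit? χ) D
  ... | yes _ = Sat⇒*≡[] χ G satG
  ... | no ¬satD = ⊥-elim (¬satD satD)

  *≡[]⇒Sat : ∀ χ G → χ * G ≡ [] → Sat χ G
  *≡[]⇒Sat χ [] e = []
  *≡[]⇒Sat χ (D ∷ G) e with Any.any? (trueLit? χ) D
  ... | yes satD = satD ∷ *≡[]⇒Sat χ G e

  private
    neither⇒nothing : ∀ {m : Maybe Bool} → m ≢ just true → m ≢ just false → m ≡ nothing
    neither⇒nothing {just true} ¬t _ = ⊥-elim (¬t refl)
    neither⇒nothing {just false} _ ¬f = ⊥-elim (¬f refl)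
    neither⇒nothing {nothing} _ _ = refl

  Sat-*⁺ : ∀ φ χ G → Sat χ (φ * G) → Sat (φ ++ χ) G
  Sat-*⁺ φ χ [] _ = []
  Sat-*⁺ φ χ (D ∷ G) sat with Any.any? (trueLit? φ) D
  ... | yes satD = Any.map (λ {x} → valLit-mono (⊑-++ˡ φ χ) x) satD ∷ Sat-*⁺ φ χ G sat
  Sat-*⁺ φ χ (D ∷ G) (satD′ ∷ sat) | no ¬satD = satD ∷ Sat-*⁺ φ χ G sat
    where
    satD : Any (λ x → valLit (φ ++ χ) x ≡ just true) D
    satD with find satD′
    ... | x , x∈D′ , χx with ∈-filter⁻ (λ x → ¬? (falseLit? φ x)) x∈D′
    ... | x∈D , ¬φx = lose x∈D (trans (valLit-++ʳ φ χ x φx≡nothing) χx)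
      where
      φx≡nothing : valLit φ x ≡ nothing
      φx≡nothing = neither⇒nothing (λ φx → ¬satD (lose x∈D φx)) ¬φx

  Sat-*⁻ : ∀ φ χ G → Sat (φ ++ χ) G → Sat χ (φ * G)
  Sat-*⁻ φ χ [] _ = []
  Sat-*⁻ φ χ (D ∷ G) (satD ∷ sat) with Any.any? (trueLit? φ) D
  ... | yes _ = Sat-*⁻ φ χ G sat
  ... | no ¬satD = satD′ ∷ Sat-*⁻ φ χ G sat
    where
    satD′ : Any (λ x → valLit χ x ≡ just true) (filter (λ x → ¬? (falseLit? φ x)) D)
    satD′ with find satD
    ... | x , x∈D , φχx = lose (∈-filter⁺ (λ x → ¬? (falseLit? φ x)) x∈D ¬φx)
                               (trans (sym (valLit-++ʳ φ χ x φx≡nothing)) φχx)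
      where
      ¬φx : valLit φ x ≢ just false
      ¬φx φx with () ← trans (sym φχx) (valLit-mono (⊑-++ˡ φ χ) x φx)
      φx≡nothing : valLit φ x ≡ nothing
      φx≡nothing = neither⇒nothing (λ φx → ¬satD (lose x∈D φx)) ¬φx

  *-⊆ : ∀ φ G {D′ x} → D′ ∈ φ * G → x ∈ D′ → ∃ λ D → D ∈ G × x ∈ D
  *-⊆ φ G D′∈ x∈ with ∈-map⁻ (filter (λ x → ¬? (falseLit? φ x))) D′∈
  ... | D , D∈ , refl =
    D , proj₁ (∈-filter⁻ (λ C → ¬? (Any.any? (trueLit? φ) C)) D∈)
      , proj₁ (∈-filter⁻ (λ x → ¬? (falseLit? φ x)) x∈)

  ∈-restrict⁻ : ∀ G W {D′} → D′ ∈ restrict G W → ∃ λ D → D ∈ G × D′ ≡ filter (λ x → var x ∈? W) D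
  ∈-restrict⁻ G W D′∈ = ∈-map⁻ (filter (λ x → var x ∈? W)) (proj₁ (∈-filter⁻ nonEmpty? {xs = map _ G} D′∈))

  ∈-restrict⁺ : ∀ {G W D x} → D ∈ G → x ∈ D → var x ∈ W → filter (λ x → var x ∈? W) D ∈ restrict G W
  ∈-restrict⁺ {G} {W} D∈ x∈ x∈W =
    ∈-filter⁺ nonEmpty? (∈-map⁺ (filter (λ x → var x ∈? W)) D∈)
              λ e → AnyP.¬Any[] (subst (_ ∈_) e (∈-filter⁺ (λ x → var x ∈? W) x∈ x∈W))

  dom-++ : ∀ φ ψ {v} → v ∈ dom (φ ++ ψ) → v ∈ dom φ ⊎ v ∈ dom ψ
  dom-++ φ ψ {v} v∈ rewrite ListP.map-++ (proj₁ {A = V} {B = λ _ → Bool}) φ ψ = ∈-++⁻ (dom φ) v∈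

  ⊑-dom : ∀ {φ ψ} → φ ⊑ ψ → (∀ {v} → v ∈ dom ψ → v ∈ dom φ) → ψ ⊑ φ
  ⊑-dom {φ} {ψ} φ⊑ψ dom⊆ v b e with ∈dom⇒lookupPA φ (dom⊆ (lookupPA⇒∈dom ψ e))
  ... | c , e′ = trans e′ (trans (sym (φ⊑ψ v c e′)) e)

  ⊑-trans : ∀ {φ ψ χ} → φ ⊑ ψ → ψ ⊑ χ → φ ⊑ χ
  ⊑-trans φ⊑ψ ψ⊑χ v b = ψ⊑χ v b ∘ φ⊑ψ v b

  ⊑-++ʳ : ∀ {φ ψ} → φ ⊑ ψ → ψ ⊑ (φ ++ ψ)
  ⊑-++ʳ {φ} {ψ} φ⊑ψ v b e with lookupPA φ v in e′
  ... | just c = trans (lookupPA-++ˡ φ ψ e′) (trans (sym (φ⊑ψ v c e′)) e)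
  ... | nothing = trans (lookupPA-++ʳ φ ψ e′) e

  AutMax-intro : ∀ {F φ} → AutR F φ → (∀ ψ → AutR F ψ → φ ⊑ ψ → ∀ {v} → v ∈ dom ψ → v ∈ dom φ) → AutMax F φ
  AutMax-intro autR dom-closed = autR , λ ψ autR-ψ φ⊑ψ → ⊑-dom φ⊑ψ (dom-closed ψ autR-ψ φ⊑ψ)

  Autarky-cong : ∀ {φ ψ} → lookupPA φ ≗ lookupPA ψ → ∀ {F} → Autarky φ F → Autarky ψ F
  Autarky-cong {φ} {ψ} φ≗ψ = All.map λ aut touch →
    Any.map (λ {x} → valLit-mono {φ} {ψ} (≗⇒⊑ {φ} {ψ} φ≗ψ) x)
            (aut (Any.map (dom-mono (≗⇒⊑ {ψ} {φ} (sym ∘ φ≗ψ))) touch))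

  ∈varCS⁺ : ∀ {G D x} → D ∈ G → x ∈ D → var x ∈ varCS G
  ∈varCS⁺ {G} D∈G x∈D =
    ∈-deduplicate⁺ _≟_ (∈-concatMap⁺ (map var) {xs = G} (lose D∈G (∈-map⁺ var x∈D)))

  ∈varCS⁻ : ∀ {G v} → v ∈ varCS G → ∃ λ D → D ∈ G × ∃ λ x → x ∈ D × var x ≡ v
  ∈varCS⁻ {G} v∈ with find (∈-concatMap⁻ (map var) {xs = G} (∈-deduplicate⁻ _≟_ (concatMap (map var) G) v∈))
  ... | D , D∈G , v∈D with ∈-map⁻ var v∈D
  ... | x , x∈D , refl = D , D∈G , x , x∈D , refl

  private
    forget : V → (V → Maybe Bool) → V → Maybe Bool
    forget u f v with v ≟ u
    ... | yes _ = nothing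
    ... | no _ = f v

    forget-≢ : ∀ {u v} f → v ≢ u → forget u f v ≡ f v
    forget-≢ {u} {v} f v≢u with v ≟ u
    ... | yes v≡u = ⊥-elim (v≢u v≡u)
    ... | no _ = refl

    forget-self : ∀ u f → forget u f u ≡ nothing
    forget-self u f with u ≟ u
    ... | yes _ = refl
    ... | no u≢u = ⊥-elim (u≢u refl)

    lookupPA-head : ∀ u b φ → lookupPA ((u , b) ∷ φ) u ≡ just b
    lookupPA-head u b φ with u ≟ u
    ... | yes _ = refl
    ... | no u≢u = ⊥-elim (u≢u refl)

    lookupPA-tail : ∀ {u v} b φ → v ≢ u → lookupPA ((u , b) ∷ φ) v ≡ lookupPA φ v
    lookupPA-tail {u} {v} b φ v≢u with v ≟ u
    ... | yes v≡u = ⊥-elim (v≢u v≡u)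
    ... | no _ = refl

    allPAss-∷ : ∀ {u us φ₀ φ} → φ₀ ∈ allPAss us →
                φ ∈ φ₀ ∷ ((u , true) ∷ φ₀) ∷ ((u , false) ∷ φ₀) ∷ [] → φ ∈ allPAss (u ∷ us)
    allPAss-∷ {us = us} φ₀∈ φ∈ = ∈-concatMap⁺ _ {xs = allPAss us} (lose φ₀∈ φ∈)

  allPAss-complete : ∀ us (f : V → Maybe Bool) → (∀ v b → f v ≡ just b → v ∈ us) →
                     ∃ λ φ → φ ∈ allPAss us × lookupPA φ ≗ f
  allPAss-complete [] f supp = [] , here refl , empty
    where
    empty : ∀ v → nothing ≡ f v
    empty v with f v in e
    ... | nothing = refl
    ... | just b with () ← supp v b e
  allPAss-complete (u ∷ us) f supp with allPAss-complete us (forget u f) supp′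
    where
    supp′ : ∀ v b → forget u f v ≡ just b → v ∈ us
    supp′ v b e with v ≟ u | supp v b
    ... | no v≢u | v∈ with v∈ e
    ...   | here v≡u = ⊥-elim (v≢u v≡u)
    ...   | there v∈us = v∈us
  ... | φ₀ , φ₀∈ , φ₀≗ with f u in fu
  ... | nothing = φ₀ , allPAss-∷ {us = us} φ₀∈ (here refl) , λ v → agree v (v ≟ u)
    where
    agree : ∀ v → Dec (v ≡ u) → lookupPA φ₀ v ≡ f v
    agree v (yes refl) = trans (φ₀≗ v) (trans (forget-self v f) (sym fu))
    agree v (no v≢u) = trans (φ₀≗ v) (forget-≢ f v≢u)
  ... | just b = (u , b) ∷ φ₀ , allPAss-∷ {us = us} φ₀∈ (choice b) , λ v → agree v (v ≟ u)
    where
    choice : ∀ b → (u , b) ∷ φ₀ ∈ φ₀ ∷ ((u , true) ∷ φ₀) ∷ ((u , false) ∷ φ₀) ∷ []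
    choice true = there (here refl)
    choice false = there (there (here refl))
    agree : ∀ v → Dec (v ≡ u) → lookupPA ((u , b) ∷ φ₀) v ≡ f v
    agree v (yes refl) = trans (lookupPA-head v b φ₀) (sym fu)
    agree v (no v≢u) = trans (lookupPA-tail b φ₀ v≢u) (trans (φ₀≗ v) (forget-≢ f v≢u))

module PA = AssignmentProperties ℕ._≟_
module WA = AssignmentProperties _≟V_

-- The translation t

tPA-prim : ∀ φ v → W.lookupPA (tPA φ) (prim v) ≡ Maybe.map (λ _ → true) (P.lookupPA φ v)
tPA-prim [] v = refl
tPA-prim ((w , b) ∷ φ) v with v ℕ.≟ w
... | yes refl = refl
... | no _ = tPA-prim φ v

tPA-tv : ∀ φ x → W.lookupPA (tPA φ) (tv x) ≡ P.valLit φ x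
tPA-tv [] (pos v) = refl
tPA-tv [] (neg v) = refl
tPA-tv ((w , b) ∷ φ) (pos v) with v ℕ.≟ w
... | yes refl = refl
... | no _ = tPA-tv φ (pos v)
tPA-tv ((w , b) ∷ φ) (neg v) with v ℕ.≟ w
... | yes refl = refl
... | no _ = tPA-tv φ (neg v)

tPA-++ : ∀ φ ψ → tPA (φ ++ ψ) ≡ tPA φ ++ tPA ψ
tPA-++ = ListP.concatMap-++ _

tPA-mono : ∀ {φ ψ} → φ P.⊑ ψ → tPA φ W.⊑ tPA ψ
tPA-mono {φ} {ψ} φ⊑ψ (prim v) c e rewrite tPA-prim φ v | tPA-prim ψ v with P.lookupPA φ v in eφ
... | just b rewrite φ⊑ψ v b eφ = e
tPA-mono {φ} {ψ} φ⊑ψ (tv x) c e rewrite tPA-tv φ x | tPA-tv ψ x = PA.valLit-mono φ⊑ψ x e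

whenTrue : Maybe Bool → Maybe Bool → Maybe Bool
whenTrue (just true) m = m
whenTrue _ _ = nothing

whenTrue≡just : ∀ {a m b} → whenTrue a m ≡ just b → a ≡ just true × m ≡ just b
whenTrue≡just {just true} e = refl , e

tInvVal : PAss Var → ℕ → Maybe Bool
tInvVal ψ v = whenTrue (W.lookupPA ψ (prim v)) (W.lookupPA ψ (tv (pos v)))

tInv-sound : ∀ ψ {v b} → (v , b) ∈ tInv ψ → tInvVal ψ v ≡ just b
tInv-sound ψ m with find (∈-concatMap⁻ _ {xs = dom ψ} m)
... | prim u , _ , m′ with W.lookupPA ψ (prim u) in e₁ | W.lookupPA ψ (tv (pos u)) in e₂
tInv-sound ψ m | prim u , _ , here refl | just true | just b = cong₂ whenTrue e₁ e₂

-- The local function of tInv cannot be named, so membership in its image is shown by contradiction.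
tInv-complete : ∀ ψ {v b} → tInvVal ψ v ≡ just b → (v , b) ∈ tInv ψ
tInv-complete ψ {v} {b} e with (v , b) ∈PAss? tInv ψ
... | yes m = m
... | no m∉ with (λ m → m∉ (∈-concatMap⁺ _ {xs = dom ψ}
                             (lose (WA.lookupPA⇒∈dom ψ (proj₁ (whenTrue≡just e))) m)))
... | ∉entry with W.lookupPA ψ (prim v) | W.lookupPA ψ (tv (pos v))
tInv-complete ψ refl | no _ | ∉entry | just true | just b = ⊥-elim (∉entry (here refl))

tInv-lookup : ∀ ψ → P.lookupPA (tInv ψ) ≗ tInvVal ψ
tInv-lookup ψ = PA.lookupPA-graph (tInv ψ) (tInvVal ψ) (tInv-sound ψ) (tInv-complete ψ)

tInv-++ : ∀ φ ψ → P.lookupPA (φ ++ tInv ψ) ≗ tInvVal (tPA φ ++ ψ)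
tInv-++ φ ψ v with P.lookupPA φ v in e
... | just c = trans (PA.lookupPA-++ˡ φ (tInv ψ) e) (sym (cong₂ whenTrue
  (WA.lookupPA-++ˡ (tPA φ) ψ (trans (tPA-prim φ v) (cong (Maybe.map _) e)))
  (WA.lookupPA-++ˡ (tPA φ) ψ (trans (tPA-tv φ (pos v)) e))))
... | nothing = trans (PA.lookupPA-++ʳ φ (tInv ψ) e) (trans (tInv-lookup ψ v) (sym (cong₂ whenTrue
  (WA.lookupPA-++ʳ (tPA φ) ψ (trans (tPA-prim φ v) (cong (Maybe.map _) e)))
  (WA.lookupPA-++ʳ (tPA φ) ψ (trans (tPA-tv φ (pos v)) e)))))

var-compl : ∀ {V : Set} (x : Lit V) → var (compl x) ≡ var x
var-compl (pos _) = refl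
var-compl (neg _) = refl

owner : Var → ℕ
owner (prim v) = v
owner (tv x) = var x

typeIClause : List ℕ → Lit ℕ → Clause ℕ → Clause Var
typeIClause Vs x C =
  neg (tv (compl x)) ∷ map (λ y → pos (tv y)) (filter (λ y → ¬? (Lit-≟ ℕ._≟_ y x) ×-dec (var y P.∈? Vs)) C)

tripleClauses : ℕ → ClauseSet Var
tripleClauses v =
    (neg (tv (pos v)) ∷ neg (tv (neg v)) ∷ [])
  ∷ (neg (prim v) ∷ pos (tv (pos v)) ∷ pos (tv (neg v)) ∷ [])
  ∷ (neg (tv (pos v)) ∷ pos (prim v) ∷ [])
  ∷ (neg (tv (neg v)) ∷ pos (prim v) ∷ [])
  ∷ []

private
  typeIClauses : List ℕ → Clause ℕ → ClauseSet Var
  typeIClauses Vs C = concatMap (λ x → typeIClause Vs x C ∷ []) (filter (λ x → var x P.∈? Vs) C)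

data TClause (Vs : List ℕ) (F : ClauseSet ℕ) : Clause Var → Set where
  typeI : ∀ {C x} → C ∈ F → x ∈ C → var x ∈ Vs → TClause Vs F (typeIClause Vs x C)
  triple : ∀ {v D} → v ∈ Vs → D ∈ tripleClauses v → TClause Vs F D

typeI∈tV : ∀ {Vs F C x} → C ∈ F → x ∈ C → var x ∈ Vs → typeIClause Vs x C ∈ tV Vs F
typeI∈tV {Vs} {F} {C} C∈F x∈C x∈Vs =
  ∈-++⁺ˡ (∈-concatMap⁺ (typeIClauses Vs) {xs = F} (lose C∈F
    (∈-concatMap⁺ _ {xs = filter (λ x → var x P.∈? Vs) C}
      (lose (∈-filter⁺ (λ x → var x P.∈? Vs) x∈C x∈Vs) (here refl)))))

triple∈tV : ∀ {Vs F v D} → v ∈ Vs → D ∈ tripleClauses v → D ∈ tV Vs F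
triple∈tV {Vs} {F} v∈Vs D∈ =
  ∈-++⁺ʳ (concatMap (typeIClauses Vs) F) (∈-concatMap⁺ tripleClauses {xs = Vs} (lose v∈Vs D∈))

tV-clause : ∀ {Vs F D} → D ∈ tV Vs F → TClause Vs F D
tV-clause {Vs} {F} D∈ with ∈-++⁻ (concatMap (typeIClauses Vs) F) D∈
... | inj₂ D∈II with find (∈-concatMap⁻ tripleClauses {xs = Vs} D∈II)
...   | v , v∈Vs , D∈III = triple v∈Vs D∈III
tV-clause {Vs} {F} D∈ | inj₁ D∈I with find (∈-concatMap⁻ (typeIClauses Vs) {xs = F} D∈I)
... | C , C∈F , D∈C with find (∈-concatMap⁻ _ {xs = filter (λ x → var x P.∈? Vs) C} D∈C)
...   | x , x∈ , here refl with ∈-filter⁻ (λ x → var x P.∈? Vs) x∈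
...     | x∈C , x∈Vs = typeI {C = C} {x = x} C∈F x∈C x∈Vs

tripleClauses-owner : ∀ v → All (All (λ ℓ → owner (var ℓ) ≡ v)) (tripleClauses v)
tripleClauses-owner v =
  (refl ∷ refl ∷ []) ∷ (refl ∷ refl ∷ refl ∷ []) ∷ (refl ∷ refl ∷ []) ∷ (refl ∷ refl ∷ []) ∷ []

tV-prim : ∀ {Vs F D ℓ v} → D ∈ tV Vs F → ℓ ∈ D → var ℓ ≡ prim v → v ∈ Vs
tV-prim {Vs} {F} D∈ ℓ∈D ℓ≡v with tV-clause {Vs} {F} D∈
... | triple {w} w∈Vs D∈III =
  subst (_∈ Vs) (trans (sym (All.lookup (All.lookup (tripleClauses-owner w) D∈III) ℓ∈D)) (cong owner ℓ≡v))
        w∈Vs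
... | typeI _ _ _ with ℓ∈D
...   | here refl with () ← ℓ≡v
...   | there ℓ∈ with ∈-map⁻ (λ y → pos (tv y)) ℓ∈
...     | _ , _ , refl with () ← ℓ≡v

-- Satisfying assignments of t(F) and autarkies of F

module TranslationSound (F : ClauseSet ℕ) (Ψ : PAss Var) (sat : WA.Sat Ψ (tCS F)) where

  private
    sat-triple : ∀ {v D} → v ∈ P.varCS F → D ∈ tripleClauses v → Any (λ ℓ → W.valLit Ψ ℓ ≡ just true) D
    sat-triple v∈ D∈ = All.lookup sat (triple∈tV {F = F} v∈ D∈)

  t-true⇒prim-true : ∀ {y} → var y ∈ P.varCS F → W.lookupPA Ψ (tv y) ≡ just true →
                     W.lookupPA Ψ (prim (var y)) ≡ just true
  t-true⇒prim-true {pos v} v∈ t with sat-triple v∈ (there (there (here refl)))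
  ... | here ¬t with () ← trans (sym t) (WA.valLit-neg⁻ Ψ _ ¬t)
  ... | there (here p) = p
  t-true⇒prim-true {neg v} v∈ t with sat-triple v∈ (there (there (there (here refl))))
  ... | here ¬t with () ← trans (sym t) (WA.valLit-neg⁻ Ψ _ ¬t)
  ... | there (here p) = p

  tneg-true⇒tpos-false : ∀ {v} → v ∈ P.varCS F → W.lookupPA Ψ (tv (neg v)) ≡ just true →
                         W.lookupPA Ψ (tv (pos v)) ≡ just false
  tneg-true⇒tpos-false v∈ t with sat-triple v∈ (here refl)
  ... | here ¬tpos = WA.valLit-neg⁻ Ψ _ ¬tpos
  ... | there (here ¬tneg) with () ← trans (sym t) (WA.valLit-neg⁻ Ψ _ ¬tneg)

  prim-true⇒tpos-false⇒tneg-true : ∀ {v} → v ∈ P.varCS F → W.lookupPA Ψ (prim v) ≡ just true →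
                                   W.lookupPA Ψ (tv (pos v)) ≡ just false →
                                   W.lookupPA Ψ (tv (neg v)) ≡ just true
  prim-true⇒tpos-false⇒tneg-true v∈ p f with sat-triple v∈ (there (here refl))
  ... | here ¬p with () ← trans (sym p) (WA.valLit-neg⁻ Ψ _ ¬p)
  ... | there (here t) with () ← trans (sym f) t
  ... | there (there (here t)) = t

  prim-true⇒tpos-assigned : ∀ {v} → v ∈ P.varCS F → W.lookupPA Ψ (prim v) ≡ just true →
                            ∃ λ b → W.lookupPA Ψ (tv (pos v)) ≡ just b
  prim-true⇒tpos-assigned {v} v∈ p with W.lookupPA Ψ (tv (pos v)) in e
  ... | just b = b , refl
  ... | nothing with sat-triple v∈ (there (here refl))
  ...   | here ¬p with () ← trans (sym p) (WA.valLit-neg⁻ Ψ _ ¬p)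
  ...   | there (here t) with () ← trans (sym e) t
  ...   | there (there (here t)) with () ← trans (sym e) (tneg-true⇒tpos-false v∈ t)

  module _ (φ : PAss ℕ) (φ≗ : P.lookupPA φ ≗ tInvVal Ψ) where

    t-true⇒true : ∀ y → var y ∈ P.varCS F → W.lookupPA Ψ (tv y) ≡ just true → P.valLit φ y ≡ just true
    t-true⇒true (pos v) v∈ t = trans (φ≗ v) (cong₂ whenTrue (t-true⇒prim-true {pos v} v∈ t) t)
    t-true⇒true (neg v) v∈ t = PA.valLit-neg⁺ φ v
      (trans (φ≗ v) (cong₂ whenTrue (t-true⇒prim-true {neg v} v∈ t) (tneg-true⇒tpos-false v∈ t)))

    false⇒t-compl-true : ∀ x → var x ∈ P.varCS F → P.valLit φ x ≡ just false →
                         W.lookupPA Ψ (tv (compl x)) ≡ just true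
    false⇒t-compl-true (pos v) v∈ f with whenTrue≡just (trans (sym (φ≗ v)) f)
    ... | p , tpos = prim-true⇒tpos-false⇒tneg-true v∈ p tpos
    false⇒t-compl-true (neg v) v∈ f = proj₂ (whenTrue≡just (trans (sym (φ≗ v)) (PA.valLit-neg⁻ φ v f)))

    typeI-sat : ∀ {C x} → C ∈ F → x ∈ C → var x ∈ P.varCS F → W.lookupPA Ψ (tv (compl x)) ≡ just true →
                Any (λ y → P.valLit φ y ≡ just true) C
    typeI-sat {C} {x} C∈F x∈C x∈ t with All.lookup sat (typeI∈tV {F = F} C∈F x∈C x∈)
    ... | here ¬t with () ← trans (sym t) (WA.valLit-neg⁻ Ψ _ ¬t)
    ... | there sat-y with find (AnyP.map⁻ sat-y)
    ...   | y , y∈ , ty with ∈-filter⁻ (λ y → ¬? (Lit-≟ ℕ._≟_ y x) ×-dec (var y P.∈? P.varCS F)) y∈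
    ...     | y∈C , _ , y∈F = lose y∈C (t-true⇒true y y∈F ty)

    tInv-autarky : P.Autarky φ F
    tInv-autarky = All.tabulate λ {C} C∈F touch → satisfied C∈F (find touch)
      where
      satisfied : ∀ {C} → C ∈ F → (∃ λ x → x ∈ C × var x ∈ dom φ) → Any (λ y → P.valLit φ y ≡ just true) C
      satisfied C∈F (x , x∈C , x∈φ) with PA.∈dom⇒valLit φ x x∈φ
      ... | true , t = lose x∈C t
      ... | false , f = typeI-sat C∈F x∈C x∈F (false⇒t-compl-true x x∈F f)
        where x∈F = PA.∈varCS⁺ C∈F x∈C

saturation : List ℕ → List Var
saturation = concatMap λ v → prim v ∷ tv (pos v) ∷ tv (neg v) ∷ []

∈-saturation : ∀ {Vs} u → owner u ∈ Vs → u ∈ saturation Vs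
∈-saturation {Vs} (prim v) v∈ = ∈-concatMap⁺ _ {xs = Vs} (lose v∈ (here refl))
∈-saturation {Vs} (tv (pos v)) v∈ = ∈-concatMap⁺ _ {xs = Vs} (lose v∈ (there (here refl)))
∈-saturation {Vs} (tv (neg v)) v∈ = ∈-concatMap⁺ _ {xs = Vs} (lose v∈ (there (there (here refl))))

triple-sat-assigned : ∀ Ψ w b → W.lookupPA Ψ (prim w) ≡ just true → W.lookupPA Ψ (tv (pos w)) ≡ just b →
                      W.lookupPA Ψ (tv (neg w)) ≡ just (not b) → WA.Sat Ψ (tripleClauses w)
triple-sat-assigned Ψ w true p t f =
  there (here (WA.valLit-neg⁺ Ψ _ f)) ∷ there (here t) ∷ there (here p) ∷ there (here p) ∷ []
triple-sat-assigned Ψ w false p f t =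
  here (WA.valLit-neg⁺ Ψ _ f) ∷ there (there (here t)) ∷ there (here p) ∷ there (here p) ∷ []

triple-sat-unassigned : ∀ Ψ w → W.lookupPA Ψ (prim w) ≡ just false → W.lookupPA Ψ (tv (pos w)) ≡ just false →
                        W.lookupPA Ψ (tv (neg w)) ≡ just false → WA.Sat Ψ (tripleClauses w)
triple-sat-unassigned Ψ w p t f =
    here (WA.valLit-neg⁺ Ψ _ t) ∷ here (WA.valLit-neg⁺ Ψ _ p)
  ∷ here (WA.valLit-neg⁺ Ψ _ t) ∷ here (WA.valLit-neg⁺ Ψ _ f) ∷ []

module TranslationComplete (F : ClauseSet ℕ) (ψ : PAss ℕ) (aut : P.Autarky ψ F) where

  tPA⁰ : PAss Var
  tPA⁰ = tPA ψ ++ map (_, false) (saturation (P.varCS F))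

  ⊑-tPA⁰ : tPA ψ W.⊑ tPA⁰
  ⊑-tPA⁰ = WA.⊑-++ˡ (tPA ψ) _

  private
    extends : ∀ {u c} → W.lookupPA (tPA ψ) u ≡ just c → W.lookupPA tPA⁰ u ≡ just c
    extends = ⊑-tPA⁰ _ _

    default : ∀ {u} → W.lookupPA (tPA ψ) u ≡ nothing → owner u ∈ P.varCS F → W.lookupPA tPA⁰ u ≡ just false
    default {u} e u∈ = trans (WA.lookupPA-++ʳ (tPA ψ) _ e) (WA.lookupPA-map false _ (∈-saturation u u∈))

    tv-false : ∀ {y} → P.valLit ψ y ≢ just true → var y ∈ P.varCS F → W.lookupPA tPA⁰ (tv y) ≡ just false
    tv-false {y} ¬t y∈ with P.valLit ψ y in e
    ... | just false = extends (trans (tPA-tv ψ y) e)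
    ... | just true = ⊥-elim (¬t refl)
    ... | nothing = default (trans (tPA-tv ψ y) e) y∈

    triple-sat : ∀ {w} → w ∈ P.varCS F → WA.Sat tPA⁰ (tripleClauses w)
    triple-sat {w} w∈ with P.lookupPA ψ w in e
    ... | just b = triple-sat-assigned tPA⁰ w b
      (extends (trans (tPA-prim ψ w) (cong (Maybe.map _) e)))
      (extends (trans (tPA-tv ψ (pos w)) e))
      (extends (trans (tPA-tv ψ (neg w)) (trans (PA.valLit-neg ψ w) (cong (Maybe.map not) e))))
    ... | nothing = triple-sat-unassigned tPA⁰ w
      (default (trans (tPA-prim ψ w) (cong (Maybe.map _) e)) w∈)
      (default (trans (tPA-tv ψ (pos w)) e) w∈)
      (default (trans (tPA-tv ψ (neg w)) (trans (PA.valLit-neg ψ w) (cong (Maybe.map not) e))) w∈)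

    typeI-sat : ∀ {C x} → C ∈ F → x ∈ C → var x ∈ P.varCS F →
                Any (λ ℓ → W.valLit tPA⁰ ℓ ≡ just true) (typeIClause (P.varCS F) x C)
    typeI-sat {C} {x} C∈F x∈C x∈ with P.falseLit? ψ x
    ... | no ¬f = here (WA.valLit-neg⁺ tPA⁰ _ (tv-false (¬f ∘ PA.valLit-compl-true⁻ ψ x)
                                                        (subst (_∈ P.varCS F) (sym (var-compl x)) x∈)))
    ... | yes f with find (All.lookup aut C∈F (lose x∈C (PA.valLit≡just⇒∈dom ψ x f)))
    ...   | y , y∈C , t = there (AnyP.map⁺ (lose
            (∈-filter⁺ (λ y → ¬? (Lit-≟ ℕ._≟_ y x) ×-dec (var y P.∈? P.varCS F)) y∈C
              ((λ { refl → true≢false (trans (sym t) f) }) , PA.∈varCS⁺ C∈F y∈C))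
            (extends (trans (tPA-tv ψ y) t))))
      where
      true≢false : just true ≢ just false
      true≢false ()

  tPA⁰-sat : WA.Sat tPA⁰ (tCS F)
  tPA⁰-sat = All.tabulate λ D∈ → sat (tV-clause {P.varCS F} {F} D∈)
    where
    sat : ∀ {D} → TClause (P.varCS F) F D → Any (λ ℓ → W.valLit tPA⁰ ℓ ≡ just true) D
    sat (typeI C∈F x∈C x∈) = typeI-sat C∈F x∈C x∈
    sat (triple w∈ D∈) = All.lookup (triple-sat w∈) D∈

-- Counting assigned variables

module _ {A : Set} {P Q : Pred A 0ℓ} (P? : Decidable P) (Q? : Decidable Q)
         (P⇒Q : ∀ {x} → P x → Q x) where

  length-filter-mono : ∀ xs → length (filter P? xs) ≤ length (filter Q? xs)
  length-filter-mono xs =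
    SublistP.length-mono-≤ (SublistP.filter⁺ P? Q? (λ { refl → P⇒Q }) (⊆-refl {x = xs}))

  length-filter-< : ∀ {x} xs → x ∈ xs → Q x → ¬ P x → length (filter P? xs) < length (filter Q? xs)
  length-filter-< (y ∷ xs) (here refl) qy ¬py with P? y | Q? y
  ... | yes py | _ = ⊥-elim (¬py py)
  ... | no _ | no ¬qy = ⊥-elim (¬qy qy)
  ... | no _ | yes _ = s≤s (length-filter-mono xs)
  length-filter-< (y ∷ xs) (there x∈) qx ¬px with ih ← length-filter-< xs x∈ qx ¬px | P? y | Q? y
  ... | yes py | no ¬qy = ⊥-elim (¬qy (P⇒Q py))
  ... | yes _ | yes _ = s≤s ih
  ... | no _ | yes _ = ℕP.m≤n⇒m≤1+n ih
  ... | no _ | no _ = ih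

assigned? : (φ : PAss ℕ) → Decidable (_∈ dom φ)
assigned? φ v = v P.∈? dom φ

assignedCount : ClauseSet ℕ → PAss ℕ → ℕ
assignedCount F φ = length (filter (assigned? φ) (P.varCS F))

assignedCount≤nVars : ∀ F φ → assignedCount F φ ≤ P.nVars F
assignedCount≤nVars F φ = ListP.length-filter (assigned? φ) (P.varCS F)

assignedCount≤nAut : ∀ F φ → P.AutR F φ → assignedCount F φ ≤ P.nAut F
assignedCount≤nAut F φ (aut , dom⊆) = length-filter-mono (assigned? φ)
  (λ v → Any.any? (λ φ → P.autarky? φ F ×-dec (v P.∈? dom φ)) (P.allPAss (P.varCS F))) witness (P.varCS F)
  where
  witness : ∀ {v} → v ∈ dom φ → Any (λ φ → P.Autarky φ F × v ∈ dom φ) (P.allPAss (P.varCS F))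
  witness v∈ with PA.allPAss-complete (P.varCS F) (P.lookupPA φ)
                                      (λ _ _ e → All.lookup dom⊆ (PA.lookupPA⇒∈dom φ e))
  ... | φ₀ , φ₀∈ , φ₀≗φ =
    lose φ₀∈ (PA.Autarky-cong (sym ∘ φ₀≗φ) aut , PA.dom-mono (PA.≗⇒⊑ {φ} {φ₀} (sym ∘ φ₀≗φ)) v∈)

-- The loop of A₁

record Invariant (F : ClauseSet ℕ) (s : State) : Set where
  field
    autarky : P.AutR F (φ s)
    pending-unassigned : ∀ {D ℓ} → D ∈ Pc s → ℓ ∈ D →
                         ∃ λ v → ℓ ≡ pos (prim v) × v ∈ P.varCS F × P.lookupPA (φ s) v ≡ nothing
    unassigned-pending : ∀ {v} → v ∈ P.varCS F → P.lookupPA (φ s) v ≡ nothing →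
                         (∃ λ D → D ∈ Pc s) × (∀ {D} → D ∈ Pc s → pos (prim v) ∈ D)
    G-sat⁺ : ∀ χ → WA.Sat χ (G s) → WA.Sat (tPA (φ s) ++ χ) (tCS F)
    G-sat⁻ : ∀ χ → WA.Sat (tPA (φ s) ++ χ) (tCS F) → WA.Sat χ (G s)
    G-prim : ∀ {D ℓ v} → D ∈ G s → ℓ ∈ D → var ℓ ≡ prim v → v ∈ P.varCS F

initial-invariant : ∀ F → Invariant F (initState F)
initial-invariant F = record
  { autarky = All.tabulate (λ _ touch → ⊥-elim (AnyP.¬Any[] (proj₂ (proj₂ (find touch))))) , []
  ; pending-unassigned = λ { (here refl) ℓ∈ → pending ℓ∈ }
  ; unassigned-pending = λ v∈ _ → (_ , here refl) , λ { (here refl) → ∈-map⁺ (λ v → pos (prim v)) v∈ }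
  ; G-sat⁺ = λ _ sat → sat
  ; G-sat⁻ = λ _ sat → sat
  ; G-prim = tV-prim {P.varCS F} {F}
  }
  where
  pending : ∀ {ℓ} → ℓ ∈ map (λ v → pos (prim v)) (P.varCS F) →
            ∃ λ v → ℓ ≡ pos (prim v) × v ∈ P.varCS F × P.lookupPA [] v ≡ nothing
  pending ℓ∈ with ∈-map⁻ (λ v → pos (prim v)) ℓ∈
  ... | v , v∈ , refl = v , refl , v∈ , refl

pending-literal : ∀ {F s} → Invariant F s → W.varCS (Pc s) ≢ [] →
                  ∃ λ D → D ∈ Pc s × ∃ λ v → pos (prim v) ∈ D × v ∈ P.varCS F × P.lookupPA (φ s) v ≡ nothing
pending-literal {s = s} inv pending with W.varCS (Pc s) in e
... | [] = ⊥-elim (pending refl)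
... | w ∷ _ with WA.∈varCS⁻ {Pc s} (subst (w ∈_) (sym e) (here refl))
...   | D , D∈ , ℓ , ℓ∈ , _ with Invariant.pending-unassigned inv D∈ ℓ∈
...     | v , refl , v∈ , unassigned = D , D∈ , v , ℓ∈ , v∈ , unassigned

module SatAnswer {F s ψ} (inv : Invariant F s) (valid : ValidAnswer (G s ++ Pc s) (satA ψ)) where
  open Invariant inv

  s′ : State
  s′ = step s (satA ψ)

  φ′ : PAss ℕ
  φ′ = φ s′

  private
    ψ-sat : WA.Sat ψ (G s ++ Pc s)
    ψ-sat = WA.*≡[]⇒Sat ψ (G s ++ Pc s) (proj₂ valid)

    ψ-sat-G : WA.Sat ψ (G s)
    ψ-sat-G = AllP.++⁻ˡ (G s) ψ-sat

    ψ-sat-P : WA.Sat ψ (Pc s)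
    ψ-sat-P = AllP.++⁻ʳ (G s) ψ-sat

    Ψ-sat : WA.Sat (tPA (φ s) ++ ψ) (tCS F)
    Ψ-sat = G-sat⁺ ψ ψ-sat-G

    query-prim : ∀ {v} → prim v ∈ W.varCS (G s ++ Pc s) → v ∈ P.varCS F
    query-prim prim∈ with WA.∈varCS⁻ {G s ++ Pc s} prim∈
    ... | D , D∈ , ℓ , ℓ∈ , ℓ≡v with ∈-++⁻ (G s) D∈
    ...   | inj₁ D∈G = G-prim D∈G ℓ∈ ℓ≡v
    ...   | inj₂ D∈P with pending-unassigned D∈P ℓ∈ | ℓ≡v
    ...     | v , refl , v∈ , _ | refl = v∈

    dom-tInv : ∀ {v} → v ∈ dom (tInv ψ) → v ∈ P.varCS F
    dom-tInv {v} v∈ with PA.∈dom⇒lookupPA (tInv ψ) v∈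
    ... | b , e = query-prim (All.lookup (proj₁ valid)
                    (WA.lookupPA⇒∈dom ψ (proj₁ (whenTrue≡just (trans (sym (tInv-lookup ψ v)) e)))))

    unassigned-split : ∀ {v} → P.lookupPA φ′ v ≡ nothing →
                       P.lookupPA (φ s) v ≡ nothing × P.lookupPA (tInv ψ) v ≡ nothing
    unassigned-split {v} e with P.lookupPA (φ s) v in e₀
    ... | just c with () ← trans (sym (PA.lookupPA-++ˡ (φ s) (tInv ψ) e₀)) e
    ... | nothing = refl , trans (sym (PA.lookupPA-++ʳ (φ s) (tInv ψ) e₀)) e

    survives? : Decidable (_∉ map prim (dom (tInv ψ)))
    survives? w = ¬? (w W.∈? map prim (dom (tInv ψ)))

    surviving : List Var
    surviving = filter survives? (W.varCS (Pc s))

    unassigned⇒prim∉dom : ∀ {v} → P.lookupPA (tInv ψ) v ≡ nothing → prim v ∉ map prim (dom (tInv ψ))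
    unassigned⇒prim∉dom {v} e prim∈ with ∈-map⁻ prim prim∈
    ... | _ , v∈ , refl = PA.lookupPA≡nothing⇒∉dom (tInv ψ) e v∈

    Ψ-unassigned : ∀ {v} → P.lookupPA (φ s) v ≡ nothing →
                   W.lookupPA (tPA (φ s) ++ ψ) (prim v) ≡ W.lookupPA ψ (prim v)
    Ψ-unassigned {v} e = WA.lookupPA-++ʳ (tPA (φ s)) ψ (trans (tPA-prim (φ s) v) (cong (Maybe.map _) e))

  autarky′ : P.AutR F φ′
  autarky′ = TranslationSound.tInv-autarky F _ Ψ-sat φ′ (tInv-++ (φ s) ψ)
           , All.tabulate λ v∈ → [ All.lookup (proj₂ autarky) , dom-tInv ]′ (PA.dom-++ (φ s) (tInv ψ) v∈)

  pending-unassigned′ : ∀ {D′ ℓ} → D′ ∈ Pc s′ → ℓ ∈ D′ →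
                        ∃ λ v → ℓ ≡ pos (prim v) × v ∈ P.varCS F × P.lookupPA φ′ v ≡ nothing
  pending-unassigned′ D′∈ ℓ∈ with WA.∈-restrict⁻ (Pc s) surviving D′∈
  ... | D , D∈ , refl with ∈-filter⁻ (λ x → var x W.∈? surviving) ℓ∈
  ... | ℓ∈D , ℓ-survives with pending-unassigned D∈ ℓ∈D
  ... | v , refl , v∈ , unassigned with P.lookupPA (tInv ψ) v in e
  ...   | nothing = v , refl , v∈ , trans (PA.lookupPA-++ʳ (φ s) (tInv ψ) unassigned) e
  ...   | just _ = ⊥-elim (proj₂ (∈-filter⁻ survives? {xs = W.varCS (Pc s)} ℓ-survives)
                                 (∈-map⁺ prim (PA.lookupPA⇒∈dom (tInv ψ) e)))

  unassigned-pending′ : ∀ {v} → v ∈ P.varCS F → P.lookupPA φ′ v ≡ nothing →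
                        (∃ λ D → D ∈ Pc s′) × (∀ {D} → D ∈ Pc s′ → pos (prim v) ∈ D)
  unassigned-pending′ {v} v∈ e with unassigned-split e
  ... | unassigned , tInv-unassigned with unassigned-pending v∈ unassigned
  ...   | (D , D∈) , all-pending =
    (_ , WA.∈-restrict⁺ D∈ (all-pending D∈) survives) , λ D′∈ → restricted (WA.∈-restrict⁻ (Pc s) surviving D′∈)
    where
    survives : prim v ∈ surviving
    survives = ∈-filter⁺ survives? (WA.∈varCS⁺ {Pc s} D∈ (all-pending D∈))
                                   (unassigned⇒prim∉dom tInv-unassigned)
    restricted : ∀ {D′} → (∃ λ D → D ∈ Pc s × D′ ≡ filter (λ x → var x W.∈? surviving) D) → pos (prim v) ∈ D′
    restricted (D , D∈ , refl) = ∈-filter⁺ (λ x → var x W.∈? surviving) (all-pending D∈) survives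

  private
    tPA-φ′ : ∀ χ → tPA (φ s) ++ (tPA (tInv ψ) ++ χ) ≡ tPA φ′ ++ χ
    tPA-φ′ χ = trans (sym (ListP.++-assoc (tPA (φ s)) (tPA (tInv ψ)) χ))
                     (cong (_++ χ) (sym (tPA-++ (φ s) (tInv ψ))))

  G-sat⁺′ : ∀ χ → WA.Sat χ (G s′) → WA.Sat (tPA φ′ ++ χ) (tCS F)
  G-sat⁺′ χ sat = subst (λ Ψ → WA.Sat Ψ (tCS F)) (tPA-φ′ χ) (G-sat⁺ _ (WA.Sat-*⁺ (tPA (tInv ψ)) χ (G s) sat))

  G-sat⁻′ : ∀ χ → WA.Sat (tPA φ′ ++ χ) (tCS F) → WA.Sat χ (G s′)
  G-sat⁻′ χ sat =
    WA.Sat-*⁻ (tPA (tInv ψ)) χ (G s) (G-sat⁻ _ (subst (λ Ψ → WA.Sat Ψ (tCS F)) (sym (tPA-φ′ χ)) sat))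

  G-prim′ : ∀ {D ℓ v} → D ∈ G s′ → ℓ ∈ D → var ℓ ≡ prim v → v ∈ P.varCS F
  G-prim′ D∈ ℓ∈ with WA.*-⊆ (tPA (tInv ψ)) (G s) D∈ ℓ∈
  ... | _ , D₀∈ , ℓ∈D₀ = G-prim D₀∈ ℓ∈D₀

  invariant : Invariant F s′
  invariant = record
    { autarky = autarky′ ; pending-unassigned = pending-unassigned′ ; unassigned-pending = unassigned-pending′
    ; G-sat⁺ = G-sat⁺′ ; G-sat⁻ = G-sat⁻′ ; G-prim = G-prim′ }

  progress : W.varCS (Pc s) ≢ [] → assignedCount F (φ s) < assignedCount F φ′
  progress pending with pending-literal inv pending
  ... | D , D∈ , _ with find (All.lookup ψ-sat-P D∈)
  ... | ℓ , ℓ∈ , ψℓ with pending-unassigned D∈ ℓ∈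
  ... | v , refl , v∈ , unassigned
    with Ψ-prim ← trans (Ψ-unassigned unassigned) ψℓ
    with TranslationSound.prim-true⇒tpos-assigned F _ Ψ-sat v∈ Ψ-prim
  ... | b , Ψ-tpos = length-filter-< (assigned? (φ s)) (assigned? φ′) (PA.dom-mono (PA.⊑-++ˡ (φ s) (tInv ψ)))
                       (P.varCS F) v∈
                       (PA.lookupPA⇒∈dom φ′ (trans (tInv-++ (φ s) ψ v) (cong₂ whenTrue Ψ-prim Ψ-tpos)))
                       (PA.lookupPA≡nothing⇒∉dom (φ s) unassigned)

module _ {F s} (inv : Invariant F s) where
  open Invariant inv

  pending⇒assignedCount< : W.varCS (Pc s) ≢ [] → assignedCount F (φ s) < P.nVars F
  pending⇒assignedCount< pending with pending-literal inv pending
  ... | _ , _ , v , _ , v∈ , unassigned =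
    ListP.filter-notAll (assigned? (φ s)) (P.varCS F) (lose v∈ (PA.lookupPA≡nothing⇒∉dom (φ s) unassigned))

  halted-maximal : W.varCS (Pc s) ≡ [] → P.AutMax F (φ s)
  halted-maximal halted =
    PA.AutMax-intro autarky λ { ψ (_ , dom⊆) _ {v} v∈ → assigned v (All.lookup dom⊆ v∈) }
    where
    assigned : ∀ v → v ∈ P.varCS F → v ∈ dom (φ s)
    assigned v v∈ with P.lookupPA (φ s) v in e
    ... | just _ = PA.lookupPA⇒∈dom (φ s) e
    ... | nothing with unassigned-pending v∈ e
    ...   | (D , D∈) , all-pending =
      ⊥-elim (AnyP.¬Any[] (subst (prim v ∈_) halted (WA.∈varCS⁺ {Pc s} D∈ (all-pending D∈))))

  unsat-maximal : ¬ W.Satisfiable (G s ++ Pc s) → P.AutMax F (φ s)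
  unsat-maximal unsat = PA.AutMax-intro autarky dom-closed
    where
    dom-closed : ∀ ψ → P.AutR F ψ → φ s P.⊑ ψ → ∀ {v} → v ∈ dom ψ → v ∈ dom (φ s)
    dom-closed ψ (aut , dom⊆) φ⊑ψ {v} v∈ with P.lookupPA (φ s) v in e
    ... | just _ = PA.lookupPA⇒∈dom (φ s) e
    ... | nothing = ⊥-elim (unsat (tPA⁰ , WA.Sat⇒*≡[] tPA⁰ (G s ++ Pc s) (AllP.++⁺ sat-G sat-P)))
      where
      open TranslationComplete F ψ aut
      sat-G : WA.Sat tPA⁰ (G s)
      sat-G = G-sat⁻ tPA⁰ (WA.Sat-mono (WA.⊑-++ʳ {tPA (φ s)} φ⊑tPA⁰) tPA⁰-sat)
        where
        φ⊑tPA⁰ : tPA (φ s) W.⊑ tPA⁰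
        φ⊑tPA⁰ = WA.⊑-trans {tPA (φ s)} {tPA ψ} {tPA⁰} (tPA-mono {φ s} {ψ} φ⊑ψ) ⊑-tPA⁰
      sat-P : WA.Sat tPA⁰ (Pc s)
      sat-P with PA.∈dom⇒lookupPA ψ v∈
      ... | b , ψv = All.tabulate λ D∈ →
        lose (proj₂ (unassigned-pending (All.lookup dom⊆ v∈) e) D∈)
             (⊑-tPA⁰ (prim v) true (trans (tPA-prim ψ v) (cong (Maybe.map _) ψv)))

run-bound : ∀ {F s r k} → Invariant F s → Run s r k →
            P.AutMax F r × k + assignedCount F (φ s) ≤ assignedCount F r + 1
                         × k + assignedCount F (φ s) ≤ P.nVars F
run-bound {F} {s} inv (halt halted) =
  halted-maximal inv halted , ℕP.m≤m+n _ 1 , assignedCount≤nVars F (φ s)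
run-bound {F} {s} inv (call {a = unsatA} pending unsat (halt _)) =
  unsat-maximal inv unsat , ℕP.≤-reflexive (ℕP.+-comm 1 _) , pending⇒assignedCount< inv pending
run-bound inv (call {a = unsatA} _ _ (call pending _ _)) = ⊥-elim (pending refl)
run-bound {F} {s} {k = suc k} inv (call {a = satA ψ} pending valid run)
  with maximal , bound-aut , bound-vars ← run-bound (SatAnswer.invariant inv valid) run =
  maximal , ℕP.≤-trans one-more bound-aut , ℕP.≤-trans one-more bound-vars
  where
  one-more : suc k + assignedCount F (φ s) ≤ k + assignedCount F (SatAnswer.φ′ inv valid)
  one-more = ℕP.+-monoʳ-< k (SatAnswer.progress inv valid pending)

terminates : ∀ fuel {F s} → Invariant F s → P.nVars F ≤ fuel + assignedCount F (φ s) → Terminates s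
terminates fuel {F} {s} inv enough with W.varCS (Pc s) in e
... | [] = halt e
... | _ ∷ _ = call pending (continue fuel enough)
  where
  pending : W.varCS (Pc s) ≢ []
  pending e′ with () ← trans (sym e) e′
  continue : ∀ fuel → P.nVars F ≤ fuel + assignedCount F (φ s) →
             ∀ a → ValidAnswer (G s ++ Pc s) a → Terminates (step s a)
  continue _ _ unsatA _ = halt refl
  continue zero enough (satA ψ) valid = ⊥-elim (ℕP.<⇒≱ (pending⇒assignedCount< inv pending) enough)
  continue (suc fuel) enough (satA ψ) valid = terminates fuel (SatAnswer.invariant inv valid)
    (ℕP.≤-trans enough (ℕP.+-monoʳ-< fuel (SatAnswer.progress inv valid pending)))

lemma4p4 : (F : ClauseSet ℕ) → ProperClauseSet F →
    Terminates (initState F) ×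
    (∀ r k → Run (initState F) r k →
       P.AutMax F r × k ≤ (P.nAut F + 1) ⊓ P.nVars F)
lemma4p4 F _ = terminates (P.nVars F) (initial-invariant F) (ℕP.m≤m+n _ _) , result
  where
  result : ∀ r k → Run (initState F) r k → P.AutMax F r × k ≤ (P.nAut F + 1) ⊓ P.nVars F
  result r k run with maximal , bound-aut , bound-vars ← run-bound (initial-invariant F) run =
    maximal , ℕP.⊓-glb
      (ℕP.≤-trans (ℕP.m≤m+n k _)
        (ℕP.≤-trans bound-aut (ℕP.+-monoˡ-≤ 1 (assignedCount≤nAut F r (proj₁ maximal)))))
      (ℕP.≤-trans (ℕP.m≤m+n k _) bound-vars)
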